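{- Let $(\mathcal{G}_n)_{n\ge1}$ be the pseudofractal scale-free web, and for $k\in\{0,1\}$ let $\alpha_n^k$ denote the largest cardinality of an independent set of $\mathcal{G}_n$ containing exactly $k$ hub vertices. Then for every $n\geq 2$, $\alpha_n^1<\alpha_n^0$.
   Context: The pseudofractal scale-free web is the sequence of simple graphs $\mathcal{G}_n$, $n\ge 1$, defined by: $\mathcal{G}_1$ is a triangle; for $n>1$, $\mathcal{G}_n$ is obtained from $\mathcal{G}_{n-1}$ by adding, for every edge $(u,v)$ of $\mathcal{G}_{n-1}$, a new vertex adjacent to exactly $u$ and $v$. The hub vertices of $\mathcal{G}_n$ are the three vertices of the initial triangle $\mathcal{G}_1$. An independent set is a set of pairwise non-adjacent vertices. -}

module Defs where

open import Data.Nat using (ℕ; zero; suc; pred; _+_)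
open import Data.Fin using (Fin; zero; suc)
open import Data.Bool using (Bool; true; false; if_then_else_)
open import Data.Sum using (_⊎_; inj₁; inj₂)
open import Data.Product using (_×_; _,_; Σ; proj₁; proj₂)
open import Data.List using (List; []; _∷_; length)
open import Data.List.Relation.Unary.AllPairs using (AllPairs)
open import Data.List.Relation.Unary.Unique.Propositional using (Unique)
open import Relation.Binary.PropositionalEquality using (_≡_)
open import Relation.Nullary using (¬_)

-- Pseudofractal scale-free web.  Internally we index from 0:
-- V m / E m are the vertex / edge sets of 𝒢_{m+1}.
mutual
  V : ℕ → Set
  V zero    = Fin 3
  V (suc m) = V m ⊎ E m          -- old vertices, plus one new vertex per old edge

  E : ℕ → Set
  E zero    = Fin 3
  E (suc m) = E m ⊎ (E m × Bool) -- old edges, plus two new edges per old edge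

ends : (m : ℕ) → E m → V m × V m
ends zero zero             = zero , suc zero
ends zero (suc zero)       = suc zero , suc (suc zero)
ends zero (suc (suc zero)) = zero , suc (suc zero)
ends (suc m) (inj₁ e) = inj₁ (proj₁ (ends m e)) , inj₁ (proj₂ (ends m e))
ends (suc m) (inj₂ (e , b)) =
  inj₂ e , inj₁ (if b then proj₁ (ends m e) else proj₂ (ends m e))

Adj' : (m : ℕ) → V m → V m → Set
Adj' m x y = Σ (E m) λ e → (ends m e ≡ (x , y)) ⊎ (ends m e ≡ (y , x))

isHub' : (m : ℕ) → V m → Bool
isHub' zero    _        = true
isHub' (suc m) (inj₁ x) = isHub' m x
isHub' (suc m) (inj₂ _) = false

-- Public interface indexed as in the paper: 𝒢_n for n ≥ 1
-- (n = 0 is a junk value equal to 𝒢_1 and is never used).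
Vertex : ℕ → Set
Vertex n = V (pred n)

Adj : (n : ℕ) → Vertex n → Vertex n → Set
Adj n = Adj' (pred n)

isHub : (n : ℕ) → Vertex n → Bool
isHub n = isHub' (pred n)

-- a finite vertex set is a duplicate-free list; its cardinality is its length
IndependentSet : (n : ℕ) → List (Vertex n) → Set
IndependentSet n S = Unique S × AllPairs (λ x y → ¬ Adj n x y) S

hubCount : (n : ℕ) → List (Vertex n) → ℕ
hubCount n []      = 0
hubCount n (x ∷ S) = (if isHub n x then 1 else 0) + hubCount n S

IndepWithHubs : (n k : ℕ) → List (Vertex n) → Set
IndepWithHubs n k S = IndependentSet n S × hubCount n S ≡ k

-- Write n = k + 2.  The new vertices of 𝒢ₙ, one per edge of 𝒢ₙ₋₁, are pairwise
-- non-adjacent and none is a hub.  Conversely, charge every vertex of an independent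
-- set S of 𝒢ₙ to an edge of 𝒢ₙ₋₁: a new vertex to its own edge, an old vertex u to a
-- fixed edge at u.  Distinct vertices charged to the same edge are adjacent, so the charge
-- is injective on S.  If S contains a hub h, an old vertex, then a second edge at h
-- is never charged, since the vertices that could claim it are neighbours of h.
-- Hence |S| is smaller than the number of edges of 𝒢ₙ₋₁.
module Submission where

open import Defs
open import Data.Nat using (ℕ; _≤_; _<_; zero; suc; pred; z≤n; s≤s)
open import Data.Nat.Properties using (≤-refl; module ≤-Reasoning)
open import Data.Bool using (Bool; true; false; if_then_else_)
open import Data.Fin using (zero; suc)
open import Data.Empty using (⊥-elim)
open import Data.Product using (Σ; ∃; _×_; _,_; proj₁; proj₂)
import Data.Product as Product
open import Data.Sum using (_⊎_; inj₁; inj₂)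
import Data.Sum as Sum
import Data.Sum.Properties as Sum
open import Data.List using (List; []; _∷_; length; map; _++_; cartesianProduct; allFin)
open import Data.List.Properties using (length-map; length-removeAt′)
open import Data.List.Membership.Propositional using (_∈_)
open import Data.List.Membership.Propositional.Properties
  using (∈-map⁺; ∈-map⁻; ∈-++⁺ˡ; ∈-++⁺ʳ; ∈-cartesianProduct⁺; ∈-allFin)
open import Data.List.Relation.Binary.Subset.Propositional using (_⊆_)
open import Data.List.Relation.Binary.Disjoint.Propositional using (Disjoint)
open import Data.List.Relation.Unary.Any using (here; there; index; _─_)
open import Data.List.Relation.Unary.All using (All)
import Data.List.Relation.Unary.All as All
import Data.List.Relation.Unary.All.Properties as All
open import Data.List.Relation.Unary.AllPairs using (AllPairs)
import Data.List.Relation.Unary.AllPairs as AllPairs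
import Data.List.Relation.Unary.AllPairs.Properties as AllPairs
open import Data.List.Relation.Unary.Unique.Propositional using (Unique; []; _∷_)
import Data.List.Relation.Unary.Unique.Propositional.Properties as Unique
open import Function using (_∘_)
open import Relation.Nullary using (¬_)
open import Relation.Binary.PropositionalEquality
  using (_≡_; _≢_; refl; sym; trans; cong; subst)

module _ {A : Set} where

  ∈-─⁺ : ∀ {x z : A} {ys} (x∈ys : x ∈ ys) → z ∈ ys → z ≢ x → z ∈ (ys ─ x∈ys)
  ∈-─⁺ (here refl)  (here refl)  z≢x = ⊥-elim (z≢x refl)
  ∈-─⁺ (here refl)  (there z∈ys) _   = z∈ys
  ∈-─⁺ (there _)    (here refl)  _   = here refl
  ∈-─⁺ (there x∈ys) (there z∈ys) z≢x = there (∈-─⁺ x∈ys z∈ys z≢x)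

  unique⇒length≤ : ∀ {xs ys : List A} → Unique xs → xs ⊆ ys → length xs ≤ length ys
  unique⇒length≤ [] _ = z≤n
  unique⇒length≤ {x ∷ xs} {ys} (x∉xs ∷ xs!) xs⊆ys = begin
    suc (length xs)           ≤⟨ s≤s (unique⇒length≤ xs! xs⊆ys─x) ⟩
    suc (length (ys ─ x∈ys))  ≡⟨ length-removeAt′ ys (index x∈ys) ⟨
    length ys                 ∎
    where
    open ≤-Reasoning
    x∈ys = xs⊆ys (here refl)
    xs⊆ys─x : xs ⊆ (ys ─ x∈ys)
    xs⊆ys─x z∈xs = ∈-─⁺ x∈ys (xs⊆ys (there z∈xs)) (All.lookup x∉xs z∈xs ∘ sym)

  AllPairs-∈ : ∀ {R : A → A → Set} {xs x y} → AllPairs R xs → x ∈ xs → y ∈ xs →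
               x ≡ y ⊎ R x y ⊎ R y x
  AllPairs-∈ (_   ∷ _)   (here refl) (here refl) = inj₁ refl
  AllPairs-∈ (Rxs ∷ _)   (here refl) (there y∈) = inj₂ (inj₁ (All.lookup Rxs y∈))
  AllPairs-∈ (Rxs ∷ _)   (there x∈)  (here refl) = inj₂ (inj₂ (All.lookup Rxs x∈))
  AllPairs-∈ (_   ∷ Rxs) (there x∈)  (there y∈) = AllPairs-∈ Rxs x∈ y∈

-- The new edge inj₂ d of level suc k joins the new vertex inj₂ (proj₁ d) to inj₁ (endpoint k d).
Dart : ℕ → Set
Dart k = E k × Bool

endpoint : (k : ℕ) → Dart k → V k
endpoint k (e , b) = if b then proj₁ (ends k e) else proj₂ (ends k e)

endpoint-inj₁ : (k : ℕ) (e : E k) (b : Bool) →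
                endpoint (suc k) (inj₁ e , b) ≡ inj₁ (endpoint k (e , b))
endpoint-inj₁ k e true  = refl
endpoint-inj₁ k e false = refl

dartAt : (k : ℕ) → V k → Dart k
dartAt zero    zero             = zero , true
dartAt zero    (suc zero)       = suc zero , true
dartAt zero    (suc (suc zero)) = suc (suc zero) , false
dartAt (suc k) (inj₁ u)         = Product.map₁ inj₁ (dartAt k u)
dartAt (suc k) (inj₂ e)         = inj₂ (e , true) , true

endpoint-dartAt : (k : ℕ) (u : V k) → endpoint k (dartAt k u) ≡ u
endpoint-dartAt zero    zero             = refl
endpoint-dartAt zero    (suc zero)       = refl
endpoint-dartAt zero    (suc (suc zero)) = refl
endpoint-dartAt (suc k) (inj₁ u)         =
  trans (endpoint-inj₁ k _ _) (cong inj₁ (endpoint-dartAt k u))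
endpoint-dartAt (suc k) (inj₂ e)         = refl

otherDartAt : (k : ℕ) → V k → Dart k
otherDartAt zero    zero             = suc (suc zero) , true
otherDartAt zero    (suc zero)       = zero , false
otherDartAt zero    (suc (suc zero)) = suc zero , false
otherDartAt (suc k) (inj₁ u)         = inj₂ (dartAt k u) , false
otherDartAt (suc k) (inj₂ e)         = inj₂ (e , false) , true

endpoint-otherDartAt : (k : ℕ) (u : V k) → endpoint k (otherDartAt k u) ≡ u
endpoint-otherDartAt zero    zero             = refl
endpoint-otherDartAt zero    (suc zero)       = refl
endpoint-otherDartAt zero    (suc (suc zero)) = refl
endpoint-otherDartAt (suc k) (inj₁ u)         = cong inj₁ (endpoint-dartAt k u)
endpoint-otherDartAt (suc k) (inj₂ e)         = refl

otherDartAt≢dartAt : (k : ℕ) (u : V k) → proj₁ (otherDartAt k u) ≢ proj₁ (dartAt k u)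
otherDartAt≢dartAt zero    zero             ()
otherDartAt≢dartAt zero    (suc zero)       ()
otherDartAt≢dartAt zero    (suc (suc zero)) ()
otherDartAt≢dartAt (suc k) (inj₁ u)         ()
otherDartAt≢dartAt (suc k) (inj₂ e)         ()

ends-distinct : (k : ℕ) (e : E k) → proj₁ (ends k e) ≢ proj₂ (ends k e)
ends-distinct zero    zero             ()
ends-distinct zero    (suc zero)       ()
ends-distinct zero    (suc (suc zero)) ()
ends-distinct (suc k) (inj₁ e)         eq = ends-distinct k e (Sum.inj₁-injective eq)
ends-distinct (suc k) (inj₂ _)         ()

Adj'-irrefl : ∀ k {x} → ¬ Adj' k x x
Adj'-irrefl k (e , inj₁ eq) = ends-distinct k e (trans (cong proj₁ eq) (sym (cong proj₂ eq)))
Adj'-irrefl k (e , inj₂ eq) = ends-distinct k e (trans (cong proj₁ eq) (sym (cong proj₂ eq)))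

Adj'-sym : ∀ k {x y} → Adj' k x y → Adj' k y x
Adj'-sym k (e , p) = e , Sum.swap p

Adj'-inj₁ : ∀ k {u v} → Adj' k u v → Adj' (suc k) (inj₁ u) (inj₁ v)
Adj'-inj₁ k (e , p) = inj₁ e , Sum.map (cong (Product.map inj₁ inj₁)) (cong (Product.map inj₁ inj₁)) p

Adj'-inj₂-endpoint : ∀ k (d : Dart k) {u} → endpoint k d ≡ u → Adj' (suc k) (inj₂ (proj₁ d)) (inj₁ u)
Adj'-inj₂-endpoint k d refl = inj₂ d , inj₁ refl

¬Adj'-inj₂ : ∀ k {a b : E k} → ¬ Adj' (suc k) (inj₂ a) (inj₂ b)
¬Adj'-inj₂ k (inj₁ _ , inj₁ ())
¬Adj'-inj₂ k (inj₁ _ , inj₂ ())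
¬Adj'-inj₂ k (inj₂ _ , inj₁ ())
¬Adj'-inj₂ k (inj₂ _ , inj₂ ())

endpoints-≡⊎Adj' : ∀ k (d d' : Dart k) {u v} → proj₁ d ≡ proj₁ d' →
                   endpoint k d ≡ u → endpoint k d' ≡ v → u ≡ v ⊎ Adj' k u v
endpoints-≡⊎Adj' k (e , true)  (.e , true)  refl refl refl = inj₁ refl
endpoints-≡⊎Adj' k (e , false) (.e , false) refl refl refl = inj₁ refl
endpoints-≡⊎Adj' k (e , true)  (.e , false) refl refl refl = inj₂ (e , inj₁ refl)
endpoints-≡⊎Adj' k (e , false) (.e , true)  refl refl refl = inj₂ (e , inj₂ refl)

charge : (k : ℕ) → V (suc k) → E k
charge k (inj₁ u) = proj₁ (dartAt k u)
charge k (inj₂ e) = e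

charge-distinct : ∀ k {x y} → x ≢ y → ¬ Adj' (suc k) x y → charge k x ≢ charge k y
charge-distinct k {inj₂ _} {inj₂ _} x≢y _ refl = x≢y refl
charge-distinct k {inj₁ u} {inj₂ _} _ ¬adj refl =
  ¬adj (Adj'-sym (suc k) (Adj'-inj₂-endpoint k (dartAt k u) (endpoint-dartAt k u)))
charge-distinct k {inj₂ _} {inj₁ v} _ ¬adj refl =
  ¬adj (Adj'-inj₂-endpoint k (dartAt k v) (endpoint-dartAt k v))
charge-distinct k {inj₁ u} {inj₁ v} x≢y ¬adj eq
  with endpoints-≡⊎Adj' k (dartAt k u) (dartAt k v) eq (endpoint-dartAt k u) (endpoint-dartAt k v)
... | inj₁ refl = x≢y refl
... | inj₂ adj  = ¬adj (Adj'-inj₁ k adj)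

charge≢otherDartAt : ∀ k h {x} → ¬ Adj' (suc k) x (inj₁ h) → charge k x ≢ proj₁ (otherDartAt k h)
charge≢otherDartAt k h {inj₂ _} ¬adj refl =
  ¬adj (Adj'-inj₂-endpoint k (otherDartAt k h) (endpoint-otherDartAt k h))
charge≢otherDartAt k h {inj₁ u} ¬adj eq
  with endpoints-≡⊎Adj' k (dartAt k u) (otherDartAt k h) eq (endpoint-dartAt k u) (endpoint-otherDartAt k h)
... | inj₁ refl = otherDartAt≢dartAt k h (sym eq)
... | inj₂ adj  = ¬adj (Adj'-inj₁ k adj)

independent-∈ : ∀ n {S x y} → IndependentSet n S → x ∈ S → y ∈ S → ¬ Adj n x y
independent-∈ n (_ , indep) x∈S y∈S with AllPairs-∈ indep x∈S y∈S
... | inj₁ refl        = Adj'-irrefl (pred n)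
... | inj₂ (inj₁ ¬adj) = ¬adj
... | inj₂ (inj₂ ¬adj) = ¬adj ∘ Adj'-sym (pred n)

bools : List Bool
bools = true ∷ false ∷ []

∈-bools : (b : Bool) → b ∈ bools
∈-bools true  = here refl
∈-bools false = there (here refl)

bools-unique : Unique bools
bools-unique = ((λ ()) All.∷ All.[]) ∷ All.[] ∷ []

allEdges : (k : ℕ) → List (E k)
allEdges zero    = allFin 3
allEdges (suc k) = map inj₁ (allEdges k) ++ map inj₂ (cartesianProduct (allEdges k) bools)

∈-allEdges : (k : ℕ) (e : E k) → e ∈ allEdges k
∈-allEdges zero    e              = ∈-allFin e
∈-allEdges (suc k) (inj₁ e)       = ∈-++⁺ˡ (∈-map⁺ inj₁ (∈-allEdges k e))
∈-allEdges (suc k) (inj₂ (e , b)) = ∈-++⁺ʳ (map inj₁ (allEdges k))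
  (∈-map⁺ inj₂ (∈-cartesianProduct⁺ (∈-allEdges k e) (∈-bools b)))

allEdges-unique : (k : ℕ) → Unique (allEdges k)
allEdges-unique zero    = Unique.allFin⁺ 3
allEdges-unique (suc k) = Unique.++⁺
  (Unique.map⁺ Sum.inj₁-injective (allEdges-unique k))
  (Unique.map⁺ Sum.inj₂-injective (Unique.cartesianProduct⁺ (allEdges-unique k) bools-unique))
  inj₁∉map-inj₂
  where
  inj₁∉map-inj₂ : Disjoint (map inj₁ (allEdges k)) (map inj₂ (cartesianProduct (allEdges k) bools))
  inj₁∉map-inj₂ (v∈inj₁ , v∈inj₂) with ∈-map⁻ inj₁ v∈inj₁ | ∈-map⁻ inj₂ v∈inj₂
  ... | _ , _ , refl | _ , _ , ()

newVertices : (k : ℕ) → List (V (suc k))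
newVertices k = map inj₂ (allEdges k)

newVertices-independent : (k : ℕ) → IndependentSet (suc (suc k)) (newVertices k)
newVertices-independent k =
  Unique.map⁺ Sum.inj₂-injective (allEdges-unique k) ,
  AllPairs.map⁺ (AllPairs.map (λ _ → ¬Adj'-inj₂ k) (allEdges-unique k))

hubCount-map-inj₂ : ∀ k (es : List (E k)) → hubCount (suc (suc k)) (map inj₂ es) ≡ 0
hubCount-map-inj₂ k []       = refl
hubCount-map-inj₂ k (_ ∷ es) = hubCount-map-inj₂ k es

hubCount≡suc⇒hub∈ : ∀ n S {m} → hubCount n S ≡ suc m → ∃ λ x → x ∈ S × isHub n x ≡ true
hubCount≡suc⇒hub∈ n (x ∷ S) eq with isHub n x in isHub-x
... | true  = x , here refl , isHub-x
... | false = Product.map₂ (Product.map₁ there) (hubCount≡suc⇒hub∈ n S eq)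

independent∋inj₁⇒length< : ∀ k {S h} → IndependentSet (suc (suc k)) S → inj₁ h ∈ S →
                           length S < length (allEdges k)
independent∋inj₁⇒length< k {S} {h} S-indep@(S-unique , S-nonadjacent) h∈S = begin-strict
  length S                       ≡⟨ length-map (charge k) S ⟨
  length (map (charge k) S)      <⟨ s≤s ≤-refl ⟩
  length (e₀ ∷ map (charge k) S) ≤⟨ unique⇒length≤ (e₀∉charges ∷ charges-unique) (λ {e} _ → ∈-allEdges k e) ⟩
  length (allEdges k)            ∎
  where
  open ≤-Reasoning
  e₀ = proj₁ (otherDartAt k h)
  charges-unique : Unique (map (charge k) S)
  charges-unique = AllPairs.map⁺ (AllPairs.map (λ (x≢y , ¬adj) → charge-distinct k x≢y ¬adj)
                                               (AllPairs.zip (S-unique , S-nonadjacent)))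
  e₀∉charges : All (e₀ ≢_) (map (charge k) S)
  e₀∉charges = All.map⁺ (All.tabulate (λ x∈S →
    charge≢otherDartAt k h (independent-∈ (suc (suc k)) S-indep x∈S h∈S) ∘ sym))

mainTheorem4 : (n : ℕ) → 2 ≤ n →
    Σ (List (Vertex n)) λ S₀ → IndepWithHubs n 0 S₀ ×
      ((S₁ : List (Vertex n)) → IndepWithHubs n 1 S₁ → length S₁ < length S₀)
mainTheorem4 (suc (suc k)) (s≤s (s≤s z≤n)) =
  newVertices k ,
  (newVertices-independent k , hubCount-map-inj₂ k (allEdges k)) ,
  smaller
  where
  smaller : (S₁ : List (V (suc k))) → IndepWithHubs (suc (suc k)) 1 S₁ →
            length S₁ < length (newVertices k)
  smaller S₁ (S₁-indep , one-hub) with hubCount≡suc⇒hub∈ (suc (suc k)) S₁ one-hub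
  ... | inj₂ _ , _ , ()
  ... | inj₁ h , h∈S₁ , _ = subst (length S₁ <_) (sym (length-map inj₂ (allEdges k)))
                                  (independent∋inj₁⇒length< k S₁-indep h∈S₁)
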